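{- Let $G=(V,E)$ be an undirected graph with weight function $w:[V]^2\to\mathbb{N}$, cost function $c:[V]^2\to\mathbb{N}^*$, and integer $B\ge0$, and let $K$ and $H$ be as defined in the context. Let $0\le\beta\le B$. Suppose that there exists a $\beta$-bounded-cost path in $K$ with weight $W$ connecting vertices $u$ and $v$. Then there exists a directed path in $H$ with weight $W$ from $(u,0)$ to $(v,\beta)$.
   Context: $[V]^2$ is the set of unordered pairs of vertices; a non-edge of $G$ is an element of $[V]^2\setminus E$. $K$ is the complete graph on $V$ with the same weights and costs as given by $w$ and $c$, together with a self-loop at every vertex having weight $0$ and cost $1$; self-loops are regarded as non-edges of $G$. The weight of a path is the sum of its edge weights; a path in $K$ is $\beta$-bounded-cost if the non-edges of $G$ it uses have total cost at most $\beta$. The directed graph $H$ has vertex set $\{(x,i): x\in V,\ 0\le i\le B\}$ and the following arcs: for every edge $\{x,y\}\in E$ and every $0\le i\le B$, the arcs $((x,i),(y,i))$ and $((y,i),(x,i))$ with weight $w(\{x,y\})$; and for every non-edge $\{x,y\}$ of $G$ (including self-loops $x=y$, with weight $0$ and cost $1$), in both directions, and every $0\le i\le B-c(\{x,y\})$, the arc $((x,i),(y,i+c(\{x,y\})))$ with weight $w(\{x,y\})$. The weight of a directed path is the sum of its arc weights. -}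

module Defs where

open import Data.Nat using (ℕ; zero; suc; _+_; _≤_)
open import Data.Fin using (Fin)
open import Data.Product using (_×_; _,_; ∃)
open import Relation.Binary.PropositionalEquality using (_≡_; _≢_)
open import Relation.Nullary using (¬_)

record Graph (n : ℕ) : Set₁ where
  field
    E     : Fin n → Fin n → Set
    E-sym : ∀ {x y} → E x y → E y x
    E-irr : ∀ {x} → ¬ E x x

-- Weights w : [V]^2 → ℕ and costs c : [V]^2 → ℕ* (positive), given as
-- symmetric functions on ordered pairs; values on the diagonal are unused
-- (the self-loops of K have weight 0 and cost 1 by definition).
record WeightCost (n : ℕ) : Set where
  field
    w     : Fin n → Fin n → ℕ
    c     : Fin n → Fin n → ℕ
    w-sym : ∀ x y → w x y ≡ w y x
    c-sym : ∀ x y → c x y ≡ c y x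
    c-pos : ∀ x y → x ≢ y → 1 ≤ c x y

module _ {n : ℕ} (G : Graph n) (wc : WeightCost n) where
  open Graph G
  open WeightCost wc

  -- Each step is an edge of G (cost 0), a non-edge
  -- {x,y} of G with x ≠ y (cost c), or a self-loop (weight 0, cost 1).
  data KPath : Fin n → Fin n → ℕ → ℕ → Set where
    [] : ∀ {x} → KPath x x 0 0
    edge∷ : ∀ {x y z W C} → E x y → KPath y z W C →
            KPath x z (w x y + W) C
    nonedge∷ : ∀ {x y z W C} → x ≢ y → ¬ E x y → KPath y z W C →
               KPath x z (w x y + W) (c x y + C)
    loop∷ : ∀ {x z W C} → KPath x z W C → KPath x z W (1 + C)

  BoundedCostPath : ℕ → Fin n → Fin n → ℕ → Set
  BoundedCostPath β u v W = ∃ λ C → KPath u v W C × C ≤ β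

  module _ (B : ℕ) where
    HVertex : Set
    HVertex = Fin n × ℕ

    data HArc : HVertex → HVertex → ℕ → Set where
      edge : ∀ {x y i} → E x y → i ≤ B →
             HArc (x , i) (y , i) (w x y)
      nonedge : ∀ {x y i} → x ≢ y → ¬ E x y → i + c x y ≤ B →
                HArc (x , i) (y , i + c x y) (w x y)
      loop : ∀ {x i} → i + 1 ≤ B → HArc (x , i) (x , i + 1) 0

    data HPath : HVertex → HVertex → ℕ → Set where
      [] : ∀ {p} → HPath p p 0
      _∷_ : ∀ {p q r a W} → HArc p q a → HPath q r W → HPath p r (a + W)

-- A path in K is followed in H by letting the level coordinate record the
-- cost spent so far: edges of G keep the level, a non-edge of cost c raises
-- it by c.  A path of cost C ≤ β is first padded with β ∸ C self-loops, so
-- that it ends exactly at level β; every intermediate level is then at most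
-- β ≤ B, so all the arcs used exist in H.
module Submission where

open import Defs
open import Data.Nat using (ℕ; _≤_; _+_; zero; suc; _∸_)
open import Data.Nat.Properties using (≤-trans; m≤m+n; +-assoc; +-identityʳ; m∸n+n≡m)
open import Data.Fin using (Fin)
open import Data.Product using (_,_)
open import Relation.Binary.PropositionalEquality using (_≡_; refl; trans; subst)

module _ {n : ℕ} (G : Graph n) (wc : WeightCost n) where

  loops∷ : ∀ {x z W C} k → KPath G wc x z W C → KPath G wc x z W (k + C)
  loops∷ zero    p = p
  loops∷ (suc k) p = loop∷ (loops∷ k p)

  padCost : ∀ {x z W C β} → C ≤ β → KPath G wc x z W C → KPath G wc x z W β
  padCost {C = C} {β} C≤β p = subst (KPath G wc _ _ _) (m∸n+n≡m C≤β) (loops∷ (β ∸ C) p)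

  open WeightCost wc using (c)

  module _ (B : ℕ) where

    private
      start≤ : ∀ {i C j} → i + C ≡ j → j ≤ B → i ≤ B
      start≤ {i} {C} refl j≤B = ≤-trans (m≤m+n i C) j≤B

    KPath⇒HPath : ∀ {x z W C i j} → KPath G wc x z W C → i + C ≡ j → j ≤ B →
                  HPath G wc B (x , i) (z , j) W
    KPath⇒HPath {i = i} [] refl _ rewrite +-identityʳ i = []
    KPath⇒HPath (edge∷ e p) eq j≤B = edge e (start≤ eq j≤B) ∷ KPath⇒HPath p eq j≤B
    KPath⇒HPath {i = i} {j} (nonedge∷ {x} {y} {C = C} x≢y ¬e p) eq j≤B =
      nonedge x≢y ¬e (start≤ eq′ j≤B) ∷ KPath⇒HPath p eq′ j≤B
      where
      eq′ : i + c x y + C ≡ j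
      eq′ = trans (+-assoc i (c x y) C) eq
    KPath⇒HPath {i = i} {j} (loop∷ {C = C} p) eq j≤B =
      loop (start≤ eq′ j≤B) ∷ KPath⇒HPath p eq′ j≤B
      where
      eq′ : i + 1 + C ≡ j
      eq′ = trans (+-assoc i 1 C) eq

lemma2 : ∀ {n} (G : Graph n) (wc : WeightCost n) (B β : ℕ) → β ≤ B →
    (u v : Fin n) (W : ℕ) → BoundedCostPath G wc β u v W →
    HPath G wc B (u , 0) (v , β) W
lemma2 G wc B β β≤B u v W (C , p , C≤β) = KPath⇒HPath G wc B (padCost G wc C≤β p) refl β≤B
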